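{- For all $n\ge 1$, $\mathsf{WOP}(X\mapsto X^n_{lex}) \le_{\mathrm{sW}} \mathsf{WOP}(X\mapsto X^\omega)[\le 2n]$.
   Context: A problem is a partial multi-valued function from instances to sets of solutions. $\mathsf P\le_{\mathrm{sW}}\mathsf Q$ means there are Turing functionals $H,K$ such that for every $\mathsf P$-instance $X$, $H(X)$ is a $\mathsf Q$-instance, and for every $\mathsf Q$-solution $\hat Y$ to $H(X)$, $K(\hat Y)$ is a $\mathsf P$-solution to $X$. $\mathsf{WOP}(X\mapsto X^n_{lex})$: an instance is a linear order $X$ together with an infinite sequence $\sigma$ in $X^n$ strictly decreasing in the lexicographic order on $X^n$; a solution is an infinite strictly decreasing sequence in $X$ whose terms occur as components of terms of $\sigma$, in the same relative order. For a linear order $(X,\le_X)$ (with $0$ its least element), $X^\omega$ is the set of finite sequences $\tau=\langle (b_0,a_0),\dots,(b_m,a_m)\rangle$ with $b_i\in\mathbb N$, $b_0>\dots>b_m$, $a_i\in X\setminus\{0\}$, ordered lexicographically: proper extensions are larger; otherwise at the first differing position $j$, $\sigma>\tau$ iff $b_j>b'_j$, or $b_j=b'_j$ and $a_j>_Xa'_j$. The length of such $\tau$ is $|\tau|=2m+2$. A sequence $\sigma'$ in $X$ is contained in a sequence $\sigma$ in $X^\omega$ if each $\sigma'_i$ is an entry $a_k$ of some term $\sigma_{t_i}$ with $t_i\le t_j$ for $i<j$. $\mathsf{WOP}(X\mapsto X^\omega)$: instance is a linear order $X$ with an infinite decreasing sequence $\sigma$ in $X^\omega$; solutions are infinite decreasing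 sequences in $X$ contained in $\sigma$. $\mathsf{WOP}(X\mapsto X^\omega)[\le k]$ is its restriction to instance sequences $(\tau_i)_{i\ge0}$ with $|\tau_i|\le k$ for all $i$. -}

module Defs where

open import Data.Nat using (ℕ; zero; suc; _+_; _*_; _≤_; _<_)
open import Data.Fin using (Fin; toℕ)
open import Data.Vec using (Vec; []; _∷_; lookup)
open import Data.List using (List; []; _∷_; map; upTo; length)
open import Data.Product using (Σ; _×_; _,_; ∃)
open import Data.Sum using (_⊎_)
open import Data.Unit using (⊤)
open import Data.Empty using (⊥)
open import Relation.Binary.PropositionalEquality using (_≡_; _≢_)

-- Oracle computation: partial recursive functions relative to an
-- oracle f : ℕ → ℕ (Kleene's characterisation of Turing functionals).

data PR : ℕ → Set where
  zer  : ∀ {k} → PR k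
  succ : PR 1
  proj : ∀ {k} → Fin k → PR k
  orc  : PR 1
  comp : ∀ {k m} → PR m → Vec (PR k) m → PR k
  prim : ∀ {k} → PR k → PR (suc (suc k)) → PR (suc k)
  mu   : ∀ {k} → PR (suc k) → PR k

mutual
  data Eval (f : ℕ → ℕ) : ∀ {k} → PR k → Vec ℕ k → ℕ → Set where
    e-zer  : ∀ {k} {xs : Vec ℕ k} → Eval f zer xs 0
    e-succ : ∀ {x} → Eval f succ (x ∷ []) (suc x)
    e-proj : ∀ {k} {i : Fin k} {xs} → Eval f (proj i) xs (lookup xs i)
    e-orc  : ∀ {x} → Eval f orc (x ∷ []) (f x)
    e-comp : ∀ {k m} {g : PR m} {hs : Vec (PR k) m} {xs ys y} →
             EvalAll f hs xs ys → Eval f g ys y → Eval f (comp g hs) xs y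
    e-prim0 : ∀ {k} {g : PR k} {h} {xs y} →
              Eval f g xs y → Eval f (prim g h) (0 ∷ xs) y
    e-primS : ∀ {k} {g : PR k} {h} {n xs r y} →
              Eval f (prim g h) (n ∷ xs) r → Eval f h (n ∷ r ∷ xs) y →
              Eval f (prim g h) (suc n ∷ xs) y
    e-mu   : ∀ {k} {g : PR (suc k)} {xs y} →
             Eval f g (y ∷ xs) 0 →
             (∀ z → z < y → Σ ℕ λ v → Eval f g (z ∷ xs) (suc v)) →
             Eval f (mu g) xs y

  data EvalAll (f : ℕ → ℕ) {k} : ∀ {m} → Vec (PR k) m → Vec ℕ k → Vec ℕ m → Set where
    ea-[] : ∀ {xs} → EvalAll f [] xs []
    ea-∷  : ∀ {m} {h} {hs : Vec (PR k) m} {xs y ys} →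
            Eval f h xs y → EvalAll f hs xs ys → EvalAll f (h ∷ hs) xs (y ∷ ys)

Computes : PR 1 → (ℕ → ℕ) → (ℕ → ℕ) → Set
Computes e f g = ∀ n → Eval f e (n ∷ []) (g n)

record Problem : Set₁ where
  field
    Inst : (ℕ → ℕ) → Set
    Sol  : (ℕ → ℕ) → (ℕ → ℕ) → Set
open Problem public

_≤sW_ : Problem → Problem → Set
P ≤sW Q = Σ (PR 1) λ H → Σ (PR 1) λ K →
  ∀ X → Inst P X →
    Σ (ℕ → ℕ) λ HX → Computes H X HX × Inst Q HX ×
      (∀ Ŷ → Sol Q HX Ŷ →
         Σ (ℕ → ℕ) λ KŶ → Computes K Ŷ KŶ × Sol P X KŶ)

tri : ℕ → ℕ
tri zero = zero
tri (suc k) = suc k + tri k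

pair : ℕ → ℕ → ℕ
pair x y = tri (x + y) + y

-- A code f presents the linear order with field  {x | f⟨0,x⟩ = 1}
-- and relation  x ≤X y  iff  f⟨1,⟨x,y⟩⟩ = 1.
-- Further data (the sequence σ) is read from f⟨2, ...⟩.

module _ (f : ℕ → ℕ) where
  Fld : ℕ → Set
  Fld x = f (pair 0 x) ≡ 1

  Le : ℕ → ℕ → Set
  Le x y = f (pair 1 (pair x y)) ≡ 1

  Lt : ℕ → ℕ → Set
  Lt x y = Le x y × x ≢ y

  record IsLinOrder : Set where
    field
      refl'   : ∀ x → Fld x → Le x x
      antisym : ∀ x y → Fld x → Fld y → Le x y → Le y x → x ≡ y
      trans'  : ∀ x y z → Fld x → Fld y → Fld z → Le x y → Le y z → Le x z
      total   : ∀ x y → Fld x → Fld y → Le x y ⊎ Le y x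

  DecSeq : (ℕ → ℕ) → Set
  DecSeq g = ∀ m → Fld (g m) × Lt (g (suc m)) (g m)

module _ (n : ℕ) (f : ℕ → ℕ) where
  σlex : ℕ → Fin n → ℕ
  σlex i j = f (pair 2 (pair i (toℕ j)))

  LexLt : (Fin n → ℕ) → (Fin n → ℕ) → Set
  LexLt u v = Σ (Fin n) λ j →
    (∀ (k : Fin n) → toℕ k < toℕ j → u k ≡ v k) × Lt f (u j) (v j)

WOPlex : ℕ → Problem
Inst (WOPlex n) f =
  IsLinOrder f ×
  (∀ i j → Fld f (σlex n f i j)) ×
  (∀ i → LexLt n f (σlex n f (suc i)) (σlex n f i))
Sol (WOPlex n) f g =
  DecSeq f g ×
  Σ (ℕ → ℕ) λ t → Σ (ℕ → Fin n) λ c →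
    (∀ m → g m ≡ σlex n f (t m) (c m)) ×
    (∀ i j → i < j → t i ≤ t j)

-- WOP(X ↦ X^ω)[≤ k].
-- τ_i = ⟨(b_0,a_0),…,(b_m,a_m)⟩ with  m+1 = f⟨2,⟨i,0⟩⟩,
-- b_j = f⟨2,⟨i,⟨1,j⟩⟩⟩,  a_j = f⟨2,⟨i,⟨2,j⟩⟩⟩.

module _ (f : ℕ → ℕ) where
  ωcount : ℕ → ℕ
  ωcount i = f (pair 2 (pair i 0))

  ωb : ℕ → ℕ → ℕ
  ωb i j = f (pair 2 (pair i (pair 1 j)))

  ωa : ℕ → ℕ → ℕ
  ωa i j = f (pair 2 (pair i (pair 2 j)))

  ωterm : ℕ → List (ℕ × ℕ)
  ωterm i = map (λ j → ωb i j , ωa i j) (upTo (ωcount i))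

  ωlen : List (ℕ × ℕ) → ℕ
  ωlen τ = 2 * length τ

  NotZero : ℕ → Set
  NotZero x = Σ ℕ λ y → Fld f y × Lt f y x

  ωLt : List (ℕ × ℕ) → List (ℕ × ℕ) → Set
  ωLt [] [] = ⊥
  ωLt [] (_ ∷ _) = ⊤
  ωLt (_ ∷ _) [] = ⊥
  ωLt ((b , a) ∷ s) ((b' , a') ∷ t) =
    b < b' ⊎ (b ≡ b' × (Lt f a a' ⊎ (a ≡ a' × ωLt s t)))

WOPω≤ : ℕ → Problem
Inst (WOPω≤ k) f =
  IsLinOrder f ×
  (∀ i → 1 ≤ ωcount f i) ×
  (∀ i j → j < ωcount f i → Fld f (ωa f i j) × NotZero f (ωa f i j)) ×
  (∀ i j → suc j < ωcount f i → ωb f i (suc j) < ωb f i j) ×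
  (∀ i → ωLt f (ωterm f (suc i)) (ωterm f i)) ×
  (∀ i → ωlen f (ωterm f i) ≤ k)
Sol (WOPω≤ k) f g =
  DecSeq f g ×
  Σ (ℕ → ℕ) λ t → Σ (ℕ → ℕ) λ c →
    (∀ m → c m < ωcount f (t m)) ×
    (∀ m → g m ≡ ωa f (t m) (c m)) ×
    (∀ i j → i < j → t i ≤ t j)

-- Adjoin a new least element 0 to X, renaming each x to x + 1, and send
-- σ_i = (x₀, …, x_{n-1}) to τ_i = ⟨(n, x₀ + 1), (n - 1, x₁ + 1), …, (1, x_{n-1} + 1)⟩,
-- of length 2n.  All τ_i carry the same exponents n > n - 1 > … > 1, so on them
-- the order of X^ω is the lexicographic order of the entries, and τ is
-- decreasing because σ is.  A decreasing sequence read off the entries of τ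
-- becomes, after subtracting 1, a decreasing sequence read off the entries of σ
-- at the same positions.

module Submission where

open import Defs
open import Data.Nat using (ℕ; zero; suc; pred; _+_; _*_; _∸_; _≤_; _<_; z≤n; s≤s; z<s)
open import Data.Nat.Properties
open import Data.Fin using (Fin; toℕ; fromℕ<) renaming (zero to fzero; suc to fsuc)
open import Data.Fin.Properties using (toℕ-fromℕ<; toℕ<n)
open import Data.Vec using (Vec; []; _∷_)
open import Data.List using (map; upTo; applyUpTo; length)
open import Data.List.Properties using (map-cong; length-map; length-upTo)
open import Data.Product using (_×_; _,_; proj₁; proj₂)
open import Data.Sum using (_⊎_; inj₁; inj₂)
open import Data.Empty using (⊥-elim)
open import Function using (_∘_; id)
open import Relation.Binary.Definitions using (tri<; tri≈; tri>)
open import Relation.Binary.PropositionalEquality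
open import Relation.Nullary using (¬_)

infixr 9 _∘ᴾ_

_∘ᴾ_ : ∀ {k} → PR 1 → PR k → PR k
P ∘ᴾ A = comp P (A ∷ [])

comp₂ : ∀ {k} → PR 2 → PR k → PR k → PR k
comp₂ P A B = comp P (A ∷ B ∷ [])

comp₃ : ∀ {k} → PR 3 → PR k → PR k → PR k → PR k
comp₃ P A B C = comp P (A ∷ B ∷ C ∷ [])

module _ {f : ℕ → ℕ} {k} {xs : Vec ℕ k} where
  eval-∘ : ∀ {P A a y} →
           Eval f A xs a → Eval f P (a ∷ []) y → Eval f (P ∘ᴾ A) xs y
  eval-∘ ea ep = e-comp (ea-∷ ea ea-[]) ep

  eval-comp₂ : ∀ {P A B a b y} →
               Eval f A xs a → Eval f B xs b → Eval f P (a ∷ b ∷ []) y →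
               Eval f (comp₂ P A B) xs y
  eval-comp₂ ea eb ep = e-comp (ea-∷ ea (ea-∷ eb ea-[])) ep

  eval-comp₃ : ∀ {P A B C a b c y} →
               Eval f A xs a → Eval f B xs b → Eval f C xs c →
               Eval f P (a ∷ b ∷ c ∷ []) y → Eval f (comp₃ P A B C) xs y
  eval-comp₃ ea eb ec ep = e-comp (ea-∷ ea (ea-∷ eb (ea-∷ ec ea-[]))) ep

constᴾ : ∀ {k} → ℕ → PR k
constᴾ zero = zer
constᴾ (suc m) = succ ∘ᴾ constᴾ m

eval-const : ∀ {f k} m {xs : Vec ℕ k} → Eval f (constᴾ m) xs m
eval-const zero = e-zer
eval-const (suc m) = eval-∘ (eval-const m) e-succ

predᴾ : PR 1
predᴾ = prim zer (proj fzero)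

eval-pred : ∀ {f} x → Eval f predᴾ (x ∷ []) (pred x)
eval-pred zero = e-prim0 e-zer
eval-pred (suc x) = e-primS (eval-pred x) e-proj

+ᴾ : PR 2
+ᴾ = prim (proj fzero) (succ ∘ᴾ proj (fsuc fzero))

eval-+ : ∀ {f} x y → Eval f +ᴾ (x ∷ y ∷ []) (x + y)
eval-+ zero y = e-prim0 e-proj
eval-+ (suc x) y = e-primS (eval-+ x y) (eval-∘ e-proj e-succ)

subtractFromᴾ : PR 2
subtractFromᴾ = prim (proj fzero) (predᴾ ∘ᴾ proj (fsuc fzero))

eval-subtractFrom : ∀ {f} y x → Eval f subtractFromᴾ (y ∷ x ∷ []) (x ∸ y)
eval-subtractFrom zero x = e-prim0 e-proj
eval-subtractFrom (suc y) x =
  subst (Eval _ subtractFromᴾ _) (pred[m∸n]≡m∸[1+n] x y)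
        (e-primS (eval-subtractFrom y x) (eval-∘ e-proj (eval-pred _)))

∸ᴾ : PR 2
∸ᴾ = comp₂ subtractFromᴾ (proj (fsuc fzero)) (proj fzero)

eval-∸ : ∀ {f} x y → Eval f ∸ᴾ (x ∷ y ∷ []) (x ∸ y)
eval-∸ x y = eval-comp₂ e-proj e-proj (eval-subtractFrom y x)

ifZero : ℕ → ℕ → ℕ → ℕ
ifZero zero a b = a
ifZero (suc _) a b = b

ifZeroᴾ : PR 3
ifZeroᴾ = prim (proj fzero) (proj (fsuc (fsuc (fsuc fzero))))

eval-ifZero : ∀ {f} k a b → Eval f ifZeroᴾ (k ∷ a ∷ b ∷ []) (ifZero k a b)
eval-ifZero zero a b = e-prim0 e-proj
eval-ifZero (suc k) a b = e-primS (eval-ifZero k a b) e-proj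

triᴾ : PR 1
triᴾ = prim zer (comp₂ +ᴾ (succ ∘ᴾ proj fzero) (proj (fsuc fzero)))

eval-tri : ∀ {f} x → Eval f triᴾ (x ∷ []) (tri x)
eval-tri zero = e-prim0 e-zer
eval-tri (suc x) =
  e-primS (eval-tri x) (eval-comp₂ (eval-∘ e-proj e-succ) e-proj (eval-+ _ _))

pairᴾ : PR 2
pairᴾ = comp₂ +ᴾ (triᴾ ∘ᴾ comp₂ +ᴾ (proj fzero) (proj (fsuc fzero))) (proj (fsuc fzero))

eval-pair : ∀ {f} x y → Eval f pairᴾ (x ∷ y ∷ []) (pair x y)
eval-pair x y =
  eval-comp₂ (eval-∘ (eval-comp₂ e-proj e-proj (eval-+ x y)) (eval-tri _)) e-proj (eval-+ _ _)

-- The truncated difference tests whether suc p has reached the next diagonal.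
diagonal : ℕ → ℕ
diagonal zero = 0
diagonal (suc p) = ifZero (tri (suc (diagonal p)) ∸ suc p) (suc (diagonal p)) (diagonal p)

unpair₂ : ℕ → ℕ
unpair₂ p = p ∸ tri (diagonal p)

unpair₁ : ℕ → ℕ
unpair₁ p = diagonal p ∸ unpair₂ p

diagonalᴾ : PR 1
diagonalᴾ = prim zer (comp₃ ifZeroᴾ (comp₂ ∸ᴾ (triᴾ ∘ᴾ succ ∘ᴾ s) (succ ∘ᴾ proj fzero)) (succ ∘ᴾ s) s)
  where
  s : PR 2
  s = proj (fsuc fzero)

eval-diagonal : ∀ {f} p → Eval f diagonalᴾ (p ∷ []) (diagonal p)
eval-diagonal zero = e-prim0 e-zer
eval-diagonal (suc p) = e-primS (eval-diagonal p)
  (eval-comp₃ (eval-comp₂ (eval-∘ (eval-∘ e-proj e-succ) (eval-tri _)) (eval-∘ e-proj e-succ) (eval-∸ _ _))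
              (eval-∘ e-proj e-succ) e-proj (eval-ifZero _ _ _))

unpair₂ᴾ : PR 1
unpair₂ᴾ = comp₂ ∸ᴾ (proj fzero) (triᴾ ∘ᴾ diagonalᴾ)

eval-unpair₂ : ∀ {f} p → Eval f unpair₂ᴾ (p ∷ []) (unpair₂ p)
eval-unpair₂ p = eval-comp₂ e-proj (eval-∘ (eval-diagonal p) (eval-tri _)) (eval-∸ _ _)

unpair₁ᴾ : PR 1
unpair₁ᴾ = comp₂ ∸ᴾ diagonalᴾ unpair₂ᴾ

eval-unpair₁ : ∀ {f} p → Eval f unpair₁ᴾ (p ∷ []) (unpair₁ p)
eval-unpair₁ p = eval-comp₂ (eval-diagonal p) (eval-unpair₂ p) (eval-∸ _ _)

tri-mono-≤ : ∀ {m n} → m ≤ n → tri m ≤ tri n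
tri-mono-≤ {n = zero} z≤n = z≤n
tri-mono-≤ {n = suc n} m≤1+n with m≤n⇒m<n∨m≡n m≤1+n
... | inj₂ refl = ≤-refl
... | inj₁ (s≤s m≤n) = ≤-trans (tri-mono-≤ m≤n) (m≤n+m (tri n) (suc n))

diagonal-bounds : ∀ p → tri (diagonal p) ≤ p × p < tri (suc (diagonal p))
diagonal-bounds zero = z≤n , s≤s z≤n
diagonal-bounds (suc p) = step _ refl (diagonal-bounds p)
  where
  s = diagonal p
  step : ∀ d → tri (suc s) ∸ suc p ≡ d → tri s ≤ p × p < tri (suc s) →
         tri (ifZero d (suc s) s) ≤ suc p × suc p < tri (suc (ifZero d (suc s) s))
  step zero eq (_ , p<) = m∸n≡0⇒m≤n eq , s≤s (≤-trans p< (m≤n+m (tri (suc s)) (suc s)))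
  step (suc d) eq (≤p , _) = m≤n⇒m≤1+n ≤p , m∸n≢0⇒n<m (λ e → 0≢1+n (trans (sym e) eq))

diagonal-unique : ∀ {s t p} → tri s ≤ p → p < tri (suc s) → tri t ≤ p → p < tri (suc t) → s ≡ t
diagonal-unique {s} {t} ≤p p< t≤p p<t with <-cmp s t
... | tri≈ _ s≡t _ = s≡t
... | tri< s<t _ _ = ⊥-elim (<⇒≱ p< (≤-trans (tri-mono-≤ s<t) t≤p))
... | tri> _ _ t<s = ⊥-elim (<⇒≱ p<t (≤-trans (tri-mono-≤ t<s) ≤p))

diagonal-pair : ∀ a b → diagonal (pair a b) ≡ a + b
diagonal-pair a b = diagonal-unique (proj₁ bounds) (proj₂ bounds) lower upper
  where
  bounds = diagonal-bounds (pair a b)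
  lower : tri (a + b) ≤ pair a b
  lower = m≤m+n (tri (a + b)) b
  upper : pair a b < tri (suc (a + b))
  upper = subst (pair a b <_) (+-comm (tri (a + b)) (suc (a + b)))
                (+-monoʳ-< (tri (a + b)) (s≤s (m≤n+m b a)))

unpair₂-pair : ∀ a b → unpair₂ (pair a b) ≡ b
unpair₂-pair a b rewrite diagonal-pair a b = m+n∸m≡n (tri (a + b)) b

unpair₁-pair : ∀ a b → unpair₁ (pair a b) ≡ a
unpair₁-pair a b rewrite unpair₂-pair a b | diagonal-pair a b = m+n∸n≡m a b

module LiftCode (n : ℕ) (X : ℕ → ℕ) where
  fieldCode : ℕ → ℕ
  fieldCode r = ifZero r 1 (X (pair 0 (pred r)))

  orderCode : ℕ → ℕ → ℕ
  orderCode u v = ifZero u 1 (ifZero v 0 (X (pair 1 (pair (pred u) (pred v)))))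

  -- At ⟨k, j⟩: k = 0 gives the length n, k = 1 the exponent b_j = n - j, k ≥ 2 the entry a_j.
  sequenceCode : ℕ → ℕ → ℕ → ℕ
  sequenceCode i k j = ifZero k n (ifZero (pred k) (n ∸ j) (suc (X (pair 2 (pair i j)))))

  liftCode : ℕ → ℕ → ℕ
  liftCode a r =
    ifZero a (fieldCode r)
      (ifZero (pred a) (orderCode (unpair₁ r) (unpair₂ r))
        (ifZero (pred (pred a))
          (sequenceCode (unpair₁ r) (unpair₁ (unpair₂ r)) (unpair₂ (unpair₂ r))) 0))

-- Opaque: unfolding unpairing at symbolic arguments makes conversion checking blow up.
opaque
  lift : ℕ → (ℕ → ℕ) → ℕ → ℕ
  lift n X p = LiftCode.liftCode n X (unpair₁ p) (unpair₂ p)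

fieldᴾ : PR 1
fieldᴾ = comp₃ ifZeroᴾ (proj fzero) (constᴾ 1) (orc ∘ᴾ comp₂ pairᴾ zer (predᴾ ∘ᴾ proj fzero))

orderᴾ : PR 1
orderᴾ = comp₃ ifZeroᴾ unpair₁ᴾ (constᴾ 1) (comp₃ ifZeroᴾ unpair₂ᴾ zer
           (orc ∘ᴾ comp₂ pairᴾ (constᴾ 1) (comp₂ pairᴾ (predᴾ ∘ᴾ unpair₁ᴾ) (predᴾ ∘ᴾ unpair₂ᴾ))))

sequenceᴾ : ℕ → PR 1
sequenceᴾ n = comp₃ ifZeroᴾ k (constᴾ n) (comp₃ ifZeroᴾ (predᴾ ∘ᴾ k) (comp₂ ∸ᴾ (constᴾ n) j)
                (succ ∘ᴾ orc ∘ᴾ comp₂ pairᴾ (constᴾ 2) (comp₂ pairᴾ unpair₁ᴾ j)))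
  where
  k = unpair₁ᴾ ∘ᴾ unpair₂ᴾ
  j = unpair₂ᴾ ∘ᴾ unpair₂ᴾ

liftᴾ : ℕ → PR 1
liftᴾ n = comp₃ ifZeroᴾ unpair₁ᴾ (fieldᴾ ∘ᴾ unpair₂ᴾ)
            (comp₃ ifZeroᴾ (predᴾ ∘ᴾ unpair₁ᴾ) (orderᴾ ∘ᴾ unpair₂ᴾ)
              (comp₃ ifZeroᴾ (predᴾ ∘ᴾ predᴾ ∘ᴾ unpair₁ᴾ) (sequenceᴾ n ∘ᴾ unpair₂ᴾ) zer))

module _ (n : ℕ) (X : ℕ → ℕ) where
  open LiftCode n X

  eval-field : ∀ r → Eval X fieldᴾ (r ∷ []) (fieldCode r)
  eval-field r = eval-comp₃ e-proj (eval-const 1)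
    (eval-∘ (eval-comp₂ e-zer (eval-∘ e-proj (eval-pred r)) (eval-pair _ _)) e-orc)
    (eval-ifZero _ _ _)

  eval-order : ∀ r → Eval X orderᴾ (r ∷ []) (orderCode (unpair₁ r) (unpair₂ r))
  eval-order r = eval-comp₃ (eval-unpair₁ r) (eval-const 1)
    (eval-comp₃ (eval-unpair₂ r) e-zer
      (eval-∘ (eval-comp₂ (eval-const 1)
                 (eval-comp₂ (eval-∘ (eval-unpair₁ r) (eval-pred _)) (eval-∘ (eval-unpair₂ r) (eval-pred _))
                             (eval-pair _ _))
                 (eval-pair _ _)) e-orc)
      (eval-ifZero _ _ _))
    (eval-ifZero _ _ _)

  eval-sequence : ∀ r → Eval X (sequenceᴾ n) (r ∷ [])
                    (sequenceCode (unpair₁ r) (unpair₁ (unpair₂ r)) (unpair₂ (unpair₂ r)))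
  eval-sequence r = eval-comp₃ eval-k (eval-const n)
    (eval-comp₃ (eval-∘ eval-k (eval-pred _)) (eval-comp₂ (eval-const n) eval-j (eval-∸ _ _))
      (eval-∘ (eval-∘ (eval-comp₂ (eval-const 2) (eval-comp₂ (eval-unpair₁ r) eval-j (eval-pair _ _))
                                 (eval-pair _ _)) e-orc) e-succ)
      (eval-ifZero _ _ _))
    (eval-ifZero _ _ _)
    where
    eval-k = eval-∘ (eval-unpair₂ r) (eval-unpair₁ _)
    eval-j = eval-∘ (eval-unpair₂ r) (eval-unpair₂ _)

  opaque
    unfolding lift

    eval-lift : Computes (liftᴾ n) X (lift n X)
    eval-lift p = eval-comp₃ eval-a (eval-∘ eval-r (eval-field _))
      (eval-comp₃ (eval-∘ eval-a (eval-pred _)) (eval-∘ eval-r (eval-order _))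
        (eval-comp₃ (eval-∘ (eval-∘ eval-a (eval-pred _)) (eval-pred _)) (eval-∘ eval-r (eval-sequence _))
                    e-zer (eval-ifZero _ _ _))
        (eval-ifZero _ _ _))
      (eval-ifZero _ _ _)
      where
      eval-a : Eval X unpair₁ᴾ (p ∷ []) (unpair₁ p)
      eval-a = eval-unpair₁ p
      eval-r : Eval X unpair₂ᴾ (p ∷ []) (unpair₂ p)
      eval-r = eval-unpair₂ p

    lift-pair : ∀ a r → lift n X (pair a r) ≡ liftCode a r
    lift-pair a r = cong₂ liftCode (unpair₁-pair a r) (unpair₂-pair a r)

  lift-order : ∀ u v → lift n X (pair 1 (pair u v)) ≡ orderCode u v
  lift-order u v = trans (lift-pair 1 (pair u v)) (cong₂ orderCode (unpair₁-pair u v) (unpair₂-pair u v))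

  lift-sequence : ∀ i k j → lift n X (pair 2 (pair i (pair k j))) ≡ sequenceCode i k j
  lift-sequence i k j = trans (lift-pair 2 (pair i (pair k j)))
    (trans (cong₂ (λ i′ q → sequenceCode i′ (unpair₁ q) (unpair₂ q)) (unpair₁-pair i _) (unpair₂-pair i _))
           (cong₂ (sequenceCode i) (unpair₁-pair k j) (unpair₂-pair k j)))

module Lifted (n : ℕ) (X : ℕ → ℕ) where
  Y : ℕ → ℕ
  Y = lift n X

  fld-zero : Fld Y 0
  fld-zero = lift-pair n X 0 0

  fld-suc⁺ : ∀ x → Fld X x → Fld Y (suc x)
  fld-suc⁺ x = trans (lift-pair n X 0 (suc x))

  fld-suc⁻ : ∀ x → Fld Y (suc x) → Fld X x
  fld-suc⁻ x = trans (sym (lift-pair n X 0 (suc x)))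

  le-zero : ∀ y → Le Y 0 y
  le-zero y = lift-order n X 0 y

  le-suc-zero : ∀ x → ¬ Le Y (suc x) 0
  le-suc-zero x h = 0≢1+n (trans (sym (lift-order n X (suc x) 0)) h)

  le-suc⁺ : ∀ x y → Le X x y → Le Y (suc x) (suc y)
  le-suc⁺ x y = trans (lift-order n X (suc x) (suc y))

  le-suc⁻ : ∀ x y → Le Y (suc x) (suc y) → Le X x y
  le-suc⁻ x y = trans (sym (lift-order n X (suc x) (suc y)))

  lt-suc⁺ : ∀ x y → Lt X x y → Lt Y (suc x) (suc y)
  lt-suc⁺ x y (x≤y , x≢y) = le-suc⁺ x y x≤y , x≢y ∘ suc-injective

  lt-suc⁻ : ∀ x y → Lt Y (suc x) (suc y) → Lt X x y
  lt-suc⁻ x y (x≤y , x≢y) = le-suc⁻ x y x≤y , x≢y ∘ cong suc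

  suc-notZero : ∀ x → NotZero Y (suc x)
  suc-notZero x = 0 , fld-zero , le-zero (suc x) , λ ()

  decSeq-suc⁻ : ∀ g → DecSeq Y (suc ∘ g) → DecSeq X g
  decSeq-suc⁻ g dec m = fld-suc⁻ (g m) (proj₁ (dec m)) , lt-suc⁻ (g (suc m)) (g m) (proj₂ (dec m))

  isLinOrder-lift : IsLinOrder X → IsLinOrder Y
  isLinOrder-lift L = record { refl' = reflexive ; antisym = antisym ; trans' = transitive ; total = total }
    where
    module L = IsLinOrder L
    reflexive : ∀ x → Fld Y x → Le Y x x
    reflexive zero _ = le-zero 0
    reflexive (suc x) fx = le-suc⁺ x x (L.refl' x (fld-suc⁻ x fx))
    antisym : ∀ x y → Fld Y x → Fld Y y → Le Y x y → Le Y y x → x ≡ y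
    antisym zero zero _ _ _ _ = refl
    antisym zero (suc y) _ _ _ h = ⊥-elim (le-suc-zero y h)
    antisym (suc x) zero _ _ h _ = ⊥-elim (le-suc-zero x h)
    antisym (suc x) (suc y) fx fy h h′ =
      cong suc (L.antisym x y (fld-suc⁻ x fx) (fld-suc⁻ y fy) (le-suc⁻ x y h) (le-suc⁻ y x h′))
    transitive : ∀ x y z → Fld Y x → Fld Y y → Fld Y z → Le Y x y → Le Y y z → Le Y x z
    transitive zero _ z _ _ _ _ _ = le-zero z
    transitive (suc x) zero _ _ _ _ h _ = ⊥-elim (le-suc-zero x h)
    transitive (suc _) (suc y) zero _ _ _ _ h = ⊥-elim (le-suc-zero y h)
    transitive (suc x) (suc y) (suc z) fx fy fz h h′ =
      le-suc⁺ x z (L.trans' x y z (fld-suc⁻ x fx) (fld-suc⁻ y fy) (fld-suc⁻ z fz) (le-suc⁻ x y h) (le-suc⁻ y z h′))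
    total : ∀ x y → Fld Y x → Fld Y y → Le Y x y ⊎ Le Y y x
    total zero y _ _ = inj₁ (le-zero y)
    total (suc x) zero _ _ = inj₂ (le-zero (suc x))
    total (suc x) (suc y) fx fy with L.total x y (fld-suc⁻ x fx) (fld-suc⁻ y fy)
    ... | inj₁ h = inj₁ (le-suc⁺ x y h)
    ... | inj₂ h = inj₂ (le-suc⁺ y x h)

  entry : ℕ → ℕ → ℕ
  entry i j = X (pair 2 (pair i j))

  ωcount-lift : ∀ i → ωcount Y i ≡ n
  ωcount-lift i = lift-sequence n X i 0 0

  ωb-lift : ∀ i j → ωb Y i j ≡ n ∸ j
  ωb-lift i j = lift-sequence n X i 1 j

  ωa-lift : ∀ i j → ωa Y i j ≡ suc (entry i j)
  ωa-lift i j = lift-sequence n X i 2 j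

  ωterm-lift : ∀ i → ωterm Y i ≡ map (λ j → n ∸ j , suc (entry i j)) (upTo n)
  ωterm-lift i = trans (cong (λ m → map (λ j → ωb Y i j , ωa Y i j) (upTo m)) (ωcount-lift i))
                       (map-cong (λ j → cong₂ _,_ (ωb-lift i j) (ωa-lift i j)) (upTo n))

  ωlen-lift : ∀ i → ωlen Y (ωterm Y i) ≡ 2 * n
  ωlen-lift i = cong (2 *_) (begin
    length (ωterm Y i)                                   ≡⟨ cong length (ωterm-lift i) ⟩
    length (map (λ j → n ∸ j , suc (entry i j)) (upTo n)) ≡⟨ length-map _ (upTo n) ⟩
    length (upTo n)                                      ≡⟨ length-upTo n ⟩
    n                                                    ∎)
    where open ≡-Reasoning

ωLt-sameExponents : ∀ (f g : ℕ → ℕ) m (b u v : ℕ → ℕ) j → j < m →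
  (∀ k → k < j → u (g k) ≡ v (g k)) → Lt f (u (g j)) (v (g j)) →
  ωLt f (map (λ k → b k , u k) (applyUpTo g m)) (map (λ k → b k , v k) (applyUpTo g m))
ωLt-sameExponents f g (suc m) b u v zero _ _ lt = inj₂ (refl , inj₁ lt)
ωLt-sameExponents f g (suc m) b u v (suc j) (s≤s j<m) eq lt =
  inj₂ (refl , inj₂ (eq 0 z<s ,
    ωLt-sameExponents f (g ∘ suc) m b u v j j<m (λ k k<j → eq (suc k) (s≤s k<j)) lt))

∀-fromFin : ∀ {n} {P : ℕ → Set} → (∀ (k : Fin n) → P (toℕ k)) → ∀ k → k < n → P k
∀-fromFin {P = P} h k k<n = subst P (toℕ-fromℕ< k<n) (h (fromℕ< k<n))

DecSeq-cong : ∀ {f g h} → (∀ m → g m ≡ h m) → DecSeq f g → DecSeq f h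
DecSeq-cong {f} g≗h dec m =
  subst (Fld f) (g≗h m) (proj₁ (dec m)) , subst₂ (Lt f) (g≗h (suc m)) (g≗h m) (proj₂ (dec m))

module Reduction (n : ℕ) (X : ℕ → ℕ) where
  open Lifted n X

  ωLt-lift : (∀ i → LexLt n X (σlex n X (suc i)) (σlex n X i)) →
             ∀ i → ωLt Y (ωterm Y (suc i)) (ωterm Y i)
  ωLt-lift lex i with lex i
  ... | j , agree , lt = subst₂ (ωLt Y) (sym (ωterm-lift (suc i))) (sym (ωterm-lift i))
    (ωLt-sameExponents Y id n (n ∸_) (suc ∘ entry (suc i)) (suc ∘ entry i) (toℕ j) (toℕ<n j)
      (λ k k<j → cong suc (∀-fromFin {P = λ k → k < toℕ j → entry (suc i) k ≡ entry i k}
                             agree k (<-trans k<j (toℕ<n j)) k<j))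
      (lt-suc⁺ _ _ lt))

  liftInstance : 1 ≤ n → Inst (WOPlex n) X → Inst (WOPω≤ (2 * n)) Y
  liftInstance 1≤n (L , fld , lex) =
    isLinOrder-lift L ,
    (λ i → subst (1 ≤_) (sym (ωcount-lift i)) 1≤n) ,
    (λ i j j< → subst (λ a → Fld Y a × NotZero Y a) (sym (ωa-lift i j))
                  (fld-suc⁺ _ (∀-fromFin (fld i) j (subst (j <_) (ωcount-lift i) j<)) , suc-notZero _)) ,
    (λ i j j< → subst₂ _<_ (sym (ωb-lift i (suc j))) (sym (ωb-lift i j))
                  (∸-monoʳ-< (n<1+n j) (<⇒≤ (subst (suc j <_) (ωcount-lift i) j<)))) ,
    ωLt-lift lex ,
    (λ i → ≤-reflexive (ωlen-lift i))

  lowerSolution : ∀ Ŷ → Sol (WOPω≤ (2 * n)) Y Ŷ → Sol (WOPlex n) X (pred ∘ Ŷ)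
  lowerSolution Ŷ (dec , t , c , c< , Ŷ≡ , t-mono) = decreasing , t , c′ , pred∘Ŷ≡ , t-mono
    where
    Ŷ≡suc : ∀ m → Ŷ m ≡ suc (entry (t m) (c m))
    Ŷ≡suc m = trans (Ŷ≡ m) (ωa-lift (t m) (c m))
    c<n : ∀ m → c m < n
    c<n m = subst (c m <_) (ωcount-lift (t m)) (c< m)
    c′ : ℕ → Fin n
    c′ m = fromℕ< (c<n m)
    decreasing : DecSeq X (pred ∘ Ŷ)
    decreasing = decSeq-suc⁻ (pred ∘ Ŷ) (DecSeq-cong {f = Y} Ŷ≡suc∘pred dec)
      where
      Ŷ≡suc∘pred : ∀ m → Ŷ m ≡ suc (pred (Ŷ m))
      Ŷ≡suc∘pred m = trans (Ŷ≡suc m) (cong (suc ∘ pred) (sym (Ŷ≡suc m)))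
    pred∘Ŷ≡ : ∀ m → pred (Ŷ m) ≡ σlex n X (t m) (c′ m)
    pred∘Ŷ≡ m = trans (cong pred (Ŷ≡suc m)) (cong (entry (t m)) (sym (toℕ-fromℕ< (c<n m))))

mainTheorem6 : ∀ (n : ℕ) → 1 ≤ n → WOPlex n ≤sW WOPω≤ (2 * n)
mainTheorem6 n 1≤n = liftᴾ n , predᴾ ∘ᴾ orc , λ X inst →
  lift n X , eval-lift n X , Reduction.liftInstance n X 1≤n inst ,
  λ Ŷ sol → pred ∘ Ŷ , (λ m → eval-∘ e-orc (eval-pred (Ŷ m))) , Reduction.lowerSolution n X Ŷ sol
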